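{- Let $\mathcal{C}$ be a deductive system on a dually integral Abelian pomonoid $\mathbf{R}=\langle R,\leq,+,0\rangle$. Then the map $\delta_{\mathcal{C}}\colon R\to\wp(R)$, $\delta_{\mathcal{C}}(x)=\bigcap\{C\in\mathcal{C}:x\in C\}$, is a deductive operator on $\mathbf{R}$.
   Context: A dually integral Abelian pomonoid: commutative monoid $\langle R,+,0\rangle$ with partial order $\leq$ such that $a\leq b\Rightarrow a+c\leq b+c$ and $0$ least. A deductive system on $\mathbf{R}$ is a family $\mathcal{C}\subseteq\wp(R)$ of $\leq$-downsets of $R$ such that $\{\delta_{\mathcal{C}}(x):x\in R\}=\mathcal{C}$ and $\delta_{\mathcal{C}}(x)\subseteq\delta_{\mathcal{C}}(y)$ implies $\delta_{\mathcal{C}}(x+z)\subseteq\delta_{\mathcal{C}}(y+z)$ for all $x,y,z$. A deductive operator on $\mathbf{R}$ is a map $\delta\colon R\to\wp(R)$ with: $a\in\delta(a)$; $a\leq b\Rightarrow\delta(a)\subseteq\delta(b)$; $a\in\delta(b)\Rightarrow\delta(a)\subseteq\delta(b)$; $a\in\delta(b)\Rightarrow a+c\in\delta(b+c)$. -}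

module Defs where

open import Level using (Level; _⊔_) renaming (suc to lsuc)
open import Data.Product using (Σ; _×_; _,_)
open import Relation.Binary.PropositionalEquality using (_≡_)
open import Relation.Binary.Structures using (IsPartialOrder)
open import Algebra.Structures using (IsCommutativeMonoid)
open import Relation.Unary using (Pred; _∈_; _⊆_)

record DIPomonoid (a ℓ : Level) : Set (lsuc (a ⊔ ℓ)) where
  field
    Carrier : Set a
    _≤_ : Carrier → Carrier → Set ℓ
    _+_ : Carrier → Carrier → Carrier
    0# : Carrier
    isCommutativeMonoid : IsCommutativeMonoid _≡_ _+_ 0#
    isPartialOrder : IsPartialOrder _≡_ _≤_
    +-mono : ∀ {x y} z → x ≤ y → (x + z) ≤ (y + z)
    0-least : ∀ x → 0# ≤ x

module _ {a ℓ : Level} (R : DIPomonoid a ℓ) where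
  open DIPomonoid R

  _≐_ : ∀ {p q} → Pred Carrier p → Pred Carrier q → Set (a ⊔ p ⊔ q)
  A ≐ B = (A ⊆ B) × (B ⊆ A)

  IsDownset : ∀ {p} → Pred Carrier p → Set (a ⊔ ℓ ⊔ p)
  IsDownset C = ∀ {x y} → x ≤ y → y ∈ C → x ∈ C

  δ : ∀ {p q} → Pred (Pred Carrier p) q → Carrier → Pred Carrier (a ⊔ lsuc p ⊔ q)
  δ 𝒞 x y = ∀ (C : Pred Carrier _) → C ∈ 𝒞 → x ∈ C → y ∈ C

  -- deductive system: a family of downsets with {δ_𝒞(x) : x ∈ R} = 𝒞
  -- (family equality taken up to extensional equality of subsets),
  -- and δ_𝒞(x) ⊆ δ_𝒞(y) ⇒ δ_𝒞(x+z) ⊆ δ_𝒞(y+z).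
  record IsDeductiveSystem {p q} (𝒞 : Pred (Pred Carrier p) q) : Set (lsuc (a ⊔ ℓ ⊔ p ⊔ q)) where
    field
      downsets : ∀ C → C ∈ 𝒞 → IsDownset C
      δ-in : ∀ x → Σ (Pred Carrier p) λ C → (C ∈ 𝒞) × (C ≐ δ 𝒞 x)
      in-δ : ∀ C → C ∈ 𝒞 → Σ Carrier λ x → C ≐ δ 𝒞 x
      compat : ∀ x y z → δ 𝒞 x ⊆ δ 𝒞 y → δ 𝒞 (x + z) ⊆ δ 𝒞 (y + z)

  record IsDeductiveOperator {p} (d : Carrier → Pred Carrier p) : Set (a ⊔ ℓ ⊔ p) where
    field
      refl∈ : ∀ x → x ∈ d x
      mono : ∀ {x y} → x ≤ y → d x ⊆ d y
      trans∈ : ∀ {x y} → x ∈ d y → d x ⊆ d y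
      shift : ∀ {x y} z → x ∈ d y → (x + z) ∈ d (y + z)

module Submission where

open import Level using (Level)
open import Relation.Unary using (Pred; _∈_; _⊆_)
open import Defs

module _ {a ℓ p q : Level} (R : DIPomonoid a ℓ)
         (𝒞 : Pred (Pred (DIPomonoid.Carrier R) p) q) where
  open DIPomonoid R

  δ-refl : ∀ x → x ∈ δ R 𝒞 x
  δ-refl x C C∈𝒞 x∈C = x∈C

  δ-trans : ∀ {x y} → x ∈ δ R 𝒞 y → δ R 𝒞 x ⊆ δ R 𝒞 y
  δ-trans x∈δy w∈δx C C∈𝒞 y∈C = w∈δx C C∈𝒞 (x∈δy C C∈𝒞 y∈C)

  δ-mono : (∀ C → C ∈ 𝒞 → IsDownset R C) →
           ∀ {x y} → x ≤ y → δ R 𝒞 x ⊆ δ R 𝒞 y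
  δ-mono downsets x≤y w∈δx C C∈𝒞 y∈C = w∈δx C C∈𝒞 (downsets C C∈𝒞 x≤y y∈C)

  -- Membership x ∈ δ y is the inclusion δ x ⊆ δ y, which compat shifts by z.
  δ-shift : (∀ x y z → δ R 𝒞 x ⊆ δ R 𝒞 y → δ R 𝒞 (x + z) ⊆ δ R 𝒞 (y + z)) →
            ∀ {x y} z → x ∈ δ R 𝒞 y → (x + z) ∈ δ R 𝒞 (y + z)
  δ-shift compat {x} {y} z x∈δy =
    compat x y z (δ-trans x∈δy) (δ-refl (x + z))

proposition3p16 : ∀ {a ℓ p q : Level} (R : DIPomonoid a ℓ)
    (𝒞 : Pred (Pred (DIPomonoid.Carrier R) p) q) →
    IsDeductiveSystem R 𝒞 → IsDeductiveOperator R (δ R 𝒞)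
proposition3p16 R 𝒞 ds = record
  { refl∈  = δ-refl R 𝒞
  ; mono   = δ-mono R 𝒞 downsets
  ; trans∈ = δ-trans R 𝒞
  ; shift  = δ-shift R 𝒞 compat
  }
  where open IsDeductiveSystem ds
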